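{- For any integer $n\ge3$, $$\gamma_{(2,2,1)}(C_n)=\gamma_{(2,2,1)}(P_n)=\begin{cases} n-\lfloor n/7\rfloor+1 & \text{if } n\equiv1,2\pmod 7,\\ n-\lfloor n/7\rfloor & \text{otherwise,}\end{cases}$$ where $C_n$ and $P_n$ are the cycle and path of order $n$.
   Context: $N(v)$ is the open neighbourhood and $f(S)=\sum_{u\in S}f(u)$. $\gamma_{(2,2,1)}(G)$ is the minimum of $\sum_v f(v)$ over functions $f:V(G)\to\{0,1,2\}$ such that $f(N(v))\ge2$ whenever $f(v)\in\{0,1\}$ and $f(N(v))\ge1$ whenever $f(v)=2$. -}

module Defs where

open import Data.Nat using (ℕ; zero; suc; _+_; _∸_; _≤_; _≡ᵇ_; _/_; _%_)
open import Data.Bool using (Bool; true; false; _∨_; _∧_; if_then_else_)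
open import Data.Fin using (Fin; toℕ)
open import Data.List using (List; map; allFin)
open import Data.Nat.ListAction using (sum)
open import Data.Product using (_×_; Σ)
open import Relation.Binary.PropositionalEquality using (_≡_)

Graph : ℕ → Set
Graph n = Fin n → Fin n → Bool

pathGraph : (n : ℕ) → Graph n
pathGraph n i j = (suc (toℕ i) ≡ᵇ toℕ j) ∨ (suc (toℕ j) ≡ᵇ toℕ i)

-- Cycle C_n: the path plus the edge {0, n-1}  (a genuine cycle when n ≥ 3).
cycleGraph : (n : ℕ) → Graph n
cycleGraph n i j =
  pathGraph n i j
  ∨ ((toℕ i ≡ᵇ 0) ∧ (suc (toℕ j) ≡ᵇ n))
  ∨ ((toℕ j ≡ᵇ 0) ∧ (suc (toℕ i) ≡ᵇ n))

Labelling : ℕ → Set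
Labelling n = Fin n → Fin 3

nbrSum : {n : ℕ} → Graph n → Labelling n → Fin n → ℕ
nbrSum {n} G f v = sum (map (λ u → if G v u then toℕ (f u) else 0) (allFin n))

weight : {n : ℕ} → Labelling n → ℕ
weight {n} f = sum (map (λ u → toℕ (f u)) (allFin n))

Is221Dom : {n : ℕ} → Graph n → Labelling n → Set
Is221Dom G f = ∀ v →
  (toℕ (f v) ≤ 1 → 2 ≤ nbrSum G f v) × (toℕ (f v) ≡ 2 → 1 ≤ nbrSum G f v)

Gamma221≡ : {n : ℕ} → Graph n → ℕ → Set
Gamma221≡ {n} G m =
  Σ (Labelling n) (λ f → Is221Dom G f × weight f ≡ m)
  × (∀ (f : Labelling n) → Is221Dom G f → m ≤ weight f)

formula : ℕ → ℕ
formula n = (n ∸ (n / 7)) + (if (n % 7 ≡ᵇ 1) ∨ (n % 7 ≡ᵇ 2) then 1 else 0)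

-- Read a labelling of C_n as a cyclic word over {0,1,2}; a letter b with neighbours a and c is
-- dominated iff demand b ≤ a + c.
-- Lower bound: fix the first two letters p q. For words of length 2 + k whose inner letters are
-- dominated, a lower bound for the weight as a function of the last two letters obeys a min-plus
-- recursion in k. Evaluating it shows that from k = 7 to k = 14 every entry grows by at least 6, and
-- this propagates to all k because the recursion commutes with adding constants. Closing the word
-- into a cycle then costs at least formula (2 + k): checked by evaluation for k < 14 and, beyond,
-- from periodicity and formula (7 + x) = 6 + formula x.
-- Upper bound: (0 2 1 0 1 2 0)^q followed by one of seven short words dominates P_n, hence also C_n.
module Submission where

open import Defs
open import Data.Bool using (Bool; true; false; T; if_then_else_; _∧_; _∨_)
open import Data.Bool.Properties using (∧-zeroʳ; ∧-identityʳ; T-∧)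
open import Data.Fin using (Fin; toℕ; fromℕ<) renaming (zero to fzero; suc to fsuc)
open import Data.Fin.Patterns using (0F; 1F; 2F)
open import Data.Fin.Properties using (all?; toℕ-fromℕ<; toℕ<n) renaming (_≟_ to _≟ᶠ_)
open import Data.List using (List; []; _∷_; _++_; map; allFin; tabulate; applyUpTo; length)
open import Data.List.Properties using (map-cong; map-tabulate; tabulate-cong; applyUpTo-∷ʳ; length-tabulate)
open import Data.Nat using (ℕ; zero; suc; pred; _+_; _∸_; _≤_; _<_; _⊓_; _/_; _%_; _≡ᵇ_; _≤?_; _<?_; z≤n; s≤s; z<s)
open import Data.Nat.DivMod using (m/n≡1+[m∸n]/n; [m+n]%n≡m%n; m/n≤m)
open import Data.Nat.Induction using (<-rec)
open import Data.Nat.ListAction using (sum)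
open import Data.Nat.ListAction.Properties using (sum-++)
open import Data.Nat.Properties
open import Algebra.Properties.CommutativeSemigroup +-commutativeSemigroup using (interchange; x∙yz≈y∙xz)
open import Data.Product using (Σ; _×_; _,_; proj₁; proj₂)
open import Data.Vec using (Vec; lookup) renaming (tabulate to tabulateᵛ)
open import Data.Vec.Properties using (lookup∘tabulate)
open import Function using (_∘_; id; _⇔_; mk⇔; Equivalence)
open import Relation.Binary.PropositionalEquality using (_≡_; refl; sym; trans; cong; cong₂; subst; module ≡-Reasoning)
open import Relation.Nullary.Decidable using (Dec; yes; no; does; ⌊_⌋; toWitness; _→-dec_; dec-true; dec-false)

sum-map-≤ : ∀ {A : Set} (xs : List A) {φ ψ : A → ℕ} →
  (∀ x → φ x ≤ ψ x) → sum (map φ xs) ≤ sum (map ψ xs)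
sum-map-≤ []       φ≤ψ = z≤n
sum-map-≤ (x ∷ xs) φ≤ψ = +-mono-≤ (φ≤ψ x) (sum-map-≤ xs φ≤ψ)

sum-map-+ : ∀ {A : Set} (xs : List A) (φ ψ : A → ℕ) →
  sum (map (λ x → φ x + ψ x) xs) ≡ sum (map φ xs) + sum (map ψ xs)
sum-map-+ []       φ ψ = refl
sum-map-+ (x ∷ xs) φ ψ =
  trans (cong (φ x + ψ x +_) (sum-map-+ xs φ ψ)) (interchange (φ x) (ψ x) _ _)

tabulate-toℕ : ∀ {A : Set} n (g : ℕ → A) → tabulate {n = n} (g ∘ toℕ) ≡ applyUpTo g n
tabulate-toℕ zero    g = refl
tabulate-toℕ (suc n) g = cong (g 0 ∷_) (tabulate-toℕ n (g ∘ suc))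

sum-allFin : ∀ n {φ : Fin n → ℕ} (g : ℕ → ℕ) → (∀ u → φ u ≡ g (toℕ u)) →
  sum (map φ (allFin n)) ≡ sum (applyUpTo g n)
sum-allFin n {φ} g φ≗g = cong sum (begin
  map φ (allFin n)   ≡⟨ map-tabulate id φ ⟩
  tabulate φ         ≡⟨ tabulate-cong φ≗g ⟩
  tabulate (g ∘ toℕ) ≡⟨ tabulate-toℕ n g ⟩
  applyUpTo g n      ∎)
  where open ≡-Reasoning

sum-applyUpTo-∷ʳ : ∀ (g : ℕ → ℕ) n → sum (applyUpTo g (suc n)) ≡ sum (applyUpTo g n) + g n
sum-applyUpTo-∷ʳ g n = begin
  sum (applyUpTo g (suc n))           ≡⟨ cong sum (applyUpTo-∷ʳ g n) ⟨
  sum (applyUpTo g n ++ (g n ∷ []))   ≡⟨ sum-++ (applyUpTo g n) (g n ∷ []) ⟩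
  sum (applyUpTo g n) + (g n + 0)     ≡⟨ cong (sum (applyUpTo g n) +_) (+-identityʳ (g n)) ⟩
  sum (applyUpTo g n) + g n           ∎
  where open ≡-Reasoning

sum-applyUpTo-0 : ∀ n → sum (applyUpTo (λ _ → 0) n) ≡ 0
sum-applyUpTo-0 zero    = refl
sum-applyUpTo-0 (suc n) = sum-applyUpTo-0 n

sum-applyUpTo-indicator : ∀ n k (g : ℕ → ℕ) → (∀ i → n ≤ i → g i ≡ 0) →
  sum (applyUpTo (λ i → if i ≡ᵇ k then g i else 0) n) ≡ g k
sum-applyUpTo-indicator zero    k       g g≡0 = sym (g≡0 k z≤n)
sum-applyUpTo-indicator (suc n) zero    g g≡0 =
  trans (cong (g 0 +_) (sum-applyUpTo-0 n)) (+-identityʳ (g 0))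
sum-applyUpTo-indicator (suc n) (suc k) g g≡0 =
  sum-applyUpTo-indicator n k (g ∘ suc) (λ i n≤i → g≡0 (suc i) (s≤s n≤i))

≡ᵇ-comm : ∀ m n → (m ≡ᵇ n) ≡ (n ≡ᵇ m)
≡ᵇ-comm zero    zero    = refl
≡ᵇ-comm zero    (suc n) = refl
≡ᵇ-comm (suc m) zero    = refl
≡ᵇ-comm (suc m) (suc n) = ≡ᵇ-comm m n

-- Words and domination

demand : Fin 3 → ℕ
demand 0F = 2
demand 1F = 2
demand 2F = 1

demand-≤⇔ : ∀ x s → ((toℕ x ≤ 1 → 2 ≤ s) × (toℕ x ≡ 2 → 1 ≤ s)) ⇔ demand x ≤ s
demand-≤⇔ 0F s = mk⇔ (λ d → proj₁ d z≤n) (λ 2≤s → (λ _ → 2≤s) , λ ())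
demand-≤⇔ 1F s = mk⇔ (λ d → proj₁ d (s≤s z≤n)) (λ 2≤s → (λ _ → 2≤s) , λ ())
demand-≤⇔ 2F s = mk⇔ (λ d → proj₂ d refl) (λ 1≤s → (λ { (s≤s ()) }) , λ _ → 1≤s)

Is221Dom⇔ : ∀ {n} (G : Graph n) (f : Labelling n) →
  Is221Dom G f ⇔ (∀ v → demand (f v) ≤ nbrSum G f v)
Is221Dom⇔ G f = mk⇔
  (λ dom v → Equivalence.to (demand-≤⇔ (f v) _) (dom v))
  (λ dem v → Equivalence.from (demand-≤⇔ (f v) _) (dem v))

Dominated : Fin 3 → Fin 3 → Fin 3 → Set
Dominated a b c = demand b ≤ toℕ a + toℕ c

dominated? : ∀ a b c → Dec (Dominated a b c)
dominated? a b c = demand b ≤? toℕ a + toℕ c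

letter : List (Fin 3) → ℕ → Fin 3
letter []      i       = 0F
letter (x ∷ w) zero    = x
letter (x ∷ w) (suc i) = letter w i

letter-beyond : ∀ w i → length w ≤ i → letter w i ≡ 0F
letter-beyond []      i       _           = refl
letter-beyond (x ∷ w) (suc i) (s≤s |w|≤i) = letter-beyond w i |w|≤i

Spells : ∀ {n} → List (Fin 3) → Labelling n → Set
Spells {n} w f = length w ≡ n × (∀ u → f u ≡ letter w (toℕ u))

tabulate-spells : ∀ {n} (f : Labelling n) → Spells (tabulate f) f
tabulate-spells f = length-tabulate f , letter-tabulate f
  where
  letter-tabulate : ∀ {n} (f : Labelling n) u → f u ≡ letter (tabulate f) (toℕ u)
  letter-tabulate f fzero    = refl
  letter-tabulate f (fsuc u) = letter-tabulate (f ∘ fsuc) u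

sum-letter : ∀ w → sum (applyUpTo (toℕ ∘ letter w) (length w)) ≡ sum (map toℕ w)
sum-letter []      = refl
sum-letter (x ∷ w) = cong (toℕ x +_) (sum-letter w)

weight-spells : ∀ {n} {w} {f : Labelling n} → Spells w f → weight f ≡ sum (applyUpTo (toℕ ∘ letter w) n)
weight-spells {n} {w} (_ , f≗w) = sum-allFin n (toℕ ∘ letter w) (cong toℕ ∘ f≗w)

-- Neighbour sums in paths and cycles

_∪_ : ∀ {n} → Graph n → Graph n → Graph n
(G ∪ H) v u = G v u ∨ H v u

successorGraph predecessorGraph wrapFirstGraph wrapLastGraph : (n : ℕ) → Graph n
successorGraph   n v u = suc (toℕ v) ≡ᵇ toℕ u
predecessorGraph n v u = suc (toℕ u) ≡ᵇ toℕ v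
wrapFirstGraph   n v u = (toℕ v ≡ᵇ 0) ∧ (suc (toℕ u) ≡ᵇ n)
wrapLastGraph    n v u = (toℕ u ≡ᵇ 0) ∧ (suc (toℕ v) ≡ᵇ n)

-- pathGraph n = successorGraph n ∪ predecessorGraph n and
-- cycleGraph n = pathGraph n ∪ (wrapFirstGraph n ∪ wrapLastGraph n), definitionally.

module _ {n} (G H : Graph n) (f : Labelling n) (v : Fin n) where

  nbrSum-⊆-∪ : nbrSum G f v ≤ nbrSum (G ∪ H) f v
  nbrSum-⊆-∪ = sum-map-≤ (allFin n) λ u → if≤if-∨ (G v u) (H v u) (toℕ (f u))
    where
    if≤if-∨ : ∀ b c x → (if b then x else 0) ≤ (if b ∨ c then x else 0)
    if≤if-∨ true  c x = ≤-refl
    if≤if-∨ false c x = z≤n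

  nbrSum-∪-≤ : nbrSum (G ∪ H) f v ≤ nbrSum G f v + nbrSum H f v
  nbrSum-∪-≤ = ≤-trans (sum-map-≤ (allFin n) λ u → if-∨≤ (G v u) (H v u) (toℕ (f u)))
                       (≤-reflexive (sum-map-+ (allFin n) _ _))
    where
    if-∨≤ : ∀ b c x → (if b ∨ c then x else 0) ≤ (if b then x else 0) + (if c then x else 0)
    if-∨≤ true  c x = m≤m+n x _
    if-∨≤ false c x = ≤-refl

  nbrSum-∪-disjoint : (∀ u → G v u ∧ H v u ≡ false) →
    nbrSum (G ∪ H) f v ≡ nbrSum G f v + nbrSum H f v
  nbrSum-∪-disjoint disjoint = trans
    (cong sum (map-cong (λ u → if-∨-disjoint (G v u) (H v u) (toℕ (f u)) (disjoint u)) (allFin n)))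
    (sum-map-+ (allFin n) _ _)
    where
    if-∨-disjoint : ∀ b c x → b ∧ c ≡ false →
      (if b ∨ c then x else 0) ≡ (if b then x else 0) + (if c then x else 0)
    if-∨-disjoint true  false x _ = sym (+-identityʳ x)
    if-∨-disjoint false c     x _ = refl

Is221Dom-∪ : ∀ {n} (G H : Graph n) (f : Labelling n) → Is221Dom G f → Is221Dom (G ∪ H) f
Is221Dom-∪ G H f dom = Equivalence.from (Is221Dom⇔ (G ∪ H) f)
  λ v → ≤-trans (Equivalence.to (Is221Dom⇔ G f) dom v) (nbrSum-⊆-∪ G H f v)

cycleNeighbours : ℕ → List (Fin 3) → ℕ → ℕ
cycleNeighbours n w a = toℕ (letter w (suc a)) + toℕ (letter (0F ∷ w) a)
  + ((if a ≡ᵇ 0 then toℕ (letter w (pred n)) else 0) + (if suc a ≡ᵇ n then toℕ (letter w 0) else 0))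

module _ {n} {w : List (Fin 3)} {f : Labelling n} (w-spells-f : Spells w f) where

  nbrSum-point : ∀ (G : Graph n) v k → (∀ u → G v u ≡ (toℕ u ≡ᵇ k)) → nbrSum G f v ≡ toℕ (letter w k)
  nbrSum-point G v k G≡ = trans
    (sum-allFin n (λ i → if i ≡ᵇ k then toℕ (letter w i) else 0) pointwise)
    (sum-applyUpTo-indicator n k (toℕ ∘ letter w) λ i n≤i →
      cong toℕ (letter-beyond w i (subst (_≤ i) (sym (proj₁ w-spells-f)) n≤i)))
    where
    pointwise : ∀ u →
      (if G v u then toℕ (f u) else 0) ≡ (if toℕ u ≡ᵇ k then toℕ (letter w (toℕ u)) else 0)
    pointwise u rewrite G≡ u | proj₂ w-spells-f u = refl

  nbrSum-empty : ∀ (G : Graph n) v → (∀ u → G v u ≡ false) → nbrSum G f v ≡ 0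
  nbrSum-empty G v G≡ =
    trans (sum-allFin n (λ _ → 0) λ u → cong (λ b → if b then toℕ (f u) else 0) (G≡ u))
          (sum-applyUpTo-0 n)

  nbrSum-path : ∀ v →
    nbrSum (pathGraph n) f v ≡ toℕ (letter w (suc (toℕ v))) + toℕ (letter (0F ∷ w) (toℕ v))
  nbrSum-path v = trans
    (nbrSum-∪-disjoint (successorGraph n) (predecessorGraph n) f v
      λ u → successor-predecessor-disjoint (toℕ v) (toℕ u))
    (cong₂ _+_ successor (predecessor v))
    where
    successor-predecessor-disjoint : ∀ a i → (suc a ≡ᵇ i) ∧ (suc i ≡ᵇ a) ≡ false
    successor-predecessor-disjoint a       zero    = refl
    successor-predecessor-disjoint zero    (suc i) = ∧-zeroʳ (0 ≡ᵇ i)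
    successor-predecessor-disjoint (suc a) (suc i) = successor-predecessor-disjoint a i
    successor : nbrSum (successorGraph n) f v ≡ toℕ (letter w (suc (toℕ v)))
    successor = nbrSum-point (successorGraph n) v _ λ u → ≡ᵇ-comm (suc (toℕ v)) (toℕ u)
    predecessor : ∀ v → nbrSum (predecessorGraph n) f v ≡ toℕ (letter (0F ∷ w) (toℕ v))
    predecessor fzero    = nbrSum-empty (predecessorGraph n) fzero λ u → refl
    predecessor (fsuc x) = nbrSum-point (predecessorGraph n) (fsuc x) (toℕ x) λ u → refl

  nbrSum-cycle-≤ : ∀ v → nbrSum (cycleGraph n) f v ≤ cycleNeighbours n w (toℕ v)
  nbrSum-cycle-≤ v = begin
    nbrSum (cycleGraph n) f v
      ≤⟨ nbrSum-∪-≤ (pathGraph n) (wrapFirstGraph n ∪ wrapLastGraph n) f v ⟩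
    nbrSum (pathGraph n) f v + nbrSum (wrapFirstGraph n ∪ wrapLastGraph n) f v
      ≤⟨ +-monoʳ-≤ _ (nbrSum-∪-≤ (wrapFirstGraph n) (wrapLastGraph n) f v) ⟩
    nbrSum (pathGraph n) f v + (nbrSum (wrapFirstGraph n) f v + nbrSum (wrapLastGraph n) f v)
      ≡⟨ cong₂ _+_ (nbrSum-path v) (cong₂ _+_ (wrapFirst v) (wrapLast _ refl)) ⟩
    cycleNeighbours n w (toℕ v) ∎
    where
    open ≤-Reasoning
    wrapFirst : ∀ v → nbrSum (wrapFirstGraph n) f v ≡ (if toℕ v ≡ᵇ 0 then toℕ (letter w (pred n)) else 0)
    wrapFirst fzero    = nbrSum-point (wrapFirstGraph n) fzero (pred n) λ u → refl
    wrapFirst (fsuc x) = nbrSum-empty (wrapFirstGraph n) (fsuc x) λ u → refl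
    wrapLast : ∀ b → (suc (toℕ v) ≡ᵇ n) ≡ b →
      nbrSum (wrapLastGraph n) f v ≡ (if b then toℕ (letter w 0) else 0)
    wrapLast true  v-last = nbrSum-point (wrapLastGraph n) v 0 λ u →
      trans (cong ((toℕ u ≡ᵇ 0) ∧_) v-last) (∧-identityʳ _)
    wrapLast false v-last = nbrSum-empty (wrapLastGraph n) v λ u →
      trans (cong ((toℕ u ≡ᵇ 0) ∧_) v-last) (∧-zeroʳ _)

  cycle-demand : Is221Dom (cycleGraph n) f → ∀ a → a < n → demand (letter w a) ≤ cycleNeighbours n w a
  cycle-demand dom a a<n = subst (λ x → demand (letter w x) ≤ cycleNeighbours n w x) (toℕ-fromℕ< a<n) (begin
    demand (letter w (toℕ v))      ≡⟨ cong demand (proj₂ w-spells-f v) ⟨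
    demand (f v)                   ≤⟨ Equivalence.to (Is221Dom⇔ (cycleGraph n) f) dom v ⟩
    nbrSum (cycleGraph n) f v      ≤⟨ nbrSum-cycle-≤ v ⟩
    cycleNeighbours n w (toℕ v)    ∎)
    where
    open ≤-Reasoning
    v = fromℕ< a<n

  Is221Dom-path : (∀ a → a < n → Dominated (letter (0F ∷ w) a) (letter w a) (letter w (suc a))) →
    Is221Dom (pathGraph n) f
  Is221Dom-path dom = Equivalence.from (Is221Dom⇔ (pathGraph n) f) λ v → begin
    demand (f v)                               ≡⟨ cong demand (proj₂ w-spells-f v) ⟩
    demand (letter w (toℕ v))                  ≤⟨ dom (toℕ v) (toℕ<n v) ⟩
    previous v + next v                        ≡⟨ +-comm (previous v) (next v) ⟩
    next v + previous v                        ≡⟨ nbrSum-path v ⟨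
    nbrSum (pathGraph n) f v                   ∎
    where
    open ≤-Reasoning
    previous next : Fin n → ℕ
    previous v = toℕ (letter (0F ∷ w) (toℕ v))
    next     v = toℕ (letter w (suc (toℕ v)))

-- Transfer-matrix lower bound

Table : Set
Table = Vec (Vec ℕ 3) 3

_[_,_] : Table → Fin 3 → Fin 3 → ℕ
t [ a , b ] = lookup (lookup t a) b

table : (Fin 3 → Fin 3 → ℕ) → Table
table g = tabulateᵛ λ a → tabulateᵛ λ b → g a b

table-[,] : ∀ g a b → table g [ a , b ] ≡ g a b
table-[,] g a b = trans (cong (λ r → lookup r b) (lookup∘tabulate (λ a → tabulateᵛ (g a)) a))
                        (lookup∘tabulate (g a) b)

minOver : (Fin 3 → ℕ) → ℕ
minOver g = g 0F ⊓ g 1F ⊓ g 2F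

minOver-≤ : ∀ g a → minOver g ≤ g a
minOver-≤ g 0F = ≤-trans (m⊓n≤m _ _) (m⊓n≤m _ _)
minOver-≤ g 1F = ≤-trans (m⊓n≤m _ _) (m⊓n≤n _ _)
minOver-≤ g 2F = m⊓n≤n _ _

minOver-raised : ∀ d g h → (∀ a → d + g a ≤ h a) → d + minOver g ≤ minOver h
minOver-raised d g h d+g≤h = begin
  d + (g 0F ⊓ g 1F ⊓ g 2F)               ≡⟨ +-distribˡ-⊓ d _ _ ⟩
  (d + (g 0F ⊓ g 1F)) ⊓ (d + g 2F)       ≡⟨ cong (_⊓ (d + g 2F)) (+-distribˡ-⊓ d _ _) ⟩
  (d + g 0F) ⊓ (d + g 1F) ⊓ (d + g 2F)   ≤⟨ ⊓-mono-≤ (⊓-mono-≤ (d+g≤h 0F) (d+g≤h 1F)) (d+g≤h 2F) ⟩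
  minOver h                              ∎
  where open ≤-Reasoning

-- The letter 2 is an admissible predecessor of any b followed by c, so minimising over
-- fallback b c a is minimising over the admissible predecessors a.
fallback : Fin 3 → Fin 3 → Fin 3 → Fin 3
fallback b c a = if does (dominated? a b c) then a else 2F

extendEntry : Table → Fin 3 → Fin 3 → ℕ
extendEntry t b c = toℕ c + minOver λ a → t [ fallback b c a , b ]

extend : Table → Table
extend t = table (extendEntry t)

extend-sound : ∀ t {a b c} → Dominated a b c → extend t [ b , c ] ≤ t [ a , b ] + toℕ c
extend-sound t {a} {b} {c} dom = begin
  extend t [ b , c ]                 ≡⟨ table-[,] (extendEntry t) b c ⟩
  toℕ c + minOver predecessorCost    ≤⟨ +-monoʳ-≤ (toℕ c) (minOver-≤ predecessorCost a) ⟩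
  toℕ c + t [ fallback b c a , b ]   ≡⟨ cong (λ x → toℕ c + t [ x , b ]) fallback-a ⟩
  toℕ c + t [ a , b ]                ≡⟨ +-comm (toℕ c) _ ⟩
  t [ a , b ] + toℕ c                ∎
  where
  open ≤-Reasoning
  predecessorCost : Fin 3 → ℕ
  predecessorCost a′ = t [ fallback b c a′ , b ]
  fallback-a : fallback b c a ≡ a
  fallback-a = cong (λ d → if d then a else 2F) (dec-true (dominated? a b c) dom)

Raised : ℕ → Table → Table → Set
Raised d t t′ = ∀ a b → d + t [ a , b ] ≤ t′ [ a , b ]

raised? : ∀ d t t′ → Dec (Raised d t t′)
raised? d t t′ = all? λ a → all? λ b → d + t [ a , b ] ≤? t′ [ a , b ]

extend-raised : ∀ {d} t t′ → Raised d t t′ → Raised d (extend t) (extend t′)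
extend-raised {d} t t′ raised b c = begin
  d + extend t [ b , c ]      ≡⟨ cong (d +_) (table-[,] (extendEntry t) b c) ⟩
  d + (toℕ c + minOver g)     ≡⟨ x∙yz≈y∙xz d (toℕ c) (minOver g) ⟩
  toℕ c + (d + minOver g)     ≤⟨ +-monoʳ-≤ (toℕ c) (minOver-raised d g g′ λ a → raised _ b) ⟩
  toℕ c + minOver g′          ≡⟨ table-[,] (extendEntry t′) b c ⟨
  extend t′ [ b , c ]         ∎
  where
  open ≤-Reasoning
  g g′ : Fin 3 → ℕ
  g  a = t  [ fallback b c a , b ]
  g′ a = t′ [ fallback b c a , b ]

-- Soundness only uses the diagonal entry; the value 4 off the diagonal (the largest weight of
-- two letters) merely has to be large enough for the finite checks below.
startEntry : Fin 3 → Fin 3 → Fin 3 → Fin 3 → ℕ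
startEntry p q a b = if does (p ≟ᶠ a) ∧ does (q ≟ᶠ b) then toℕ p + toℕ q else 4

weightBound : ℕ → Fin 3 → Fin 3 → Table
weightBound zero    p q = table (startEntry p q)
weightBound (suc k) p q = extend (weightBound k p q)

weightBound-sound : ∀ (y : ℕ → Fin 3) k →
  (∀ i → i < k → Dominated (y i) (y (suc i)) (y (suc (suc i)))) →
  weightBound k (y 0) (y 1) [ y k , y (suc k) ] ≤ sum (applyUpTo (toℕ ∘ y) (2 + k))
weightBound-sound y zero    _   = ≤-reflexive (begin
  table (startEntry (y 0) (y 1)) [ y 0 , y 1 ] ≡⟨ table-[,] (startEntry (y 0) (y 1)) (y 0) (y 1) ⟩
  startEntry (y 0) (y 1) (y 0) (y 1)           ≡⟨ cong₂ (λ d e → if d ∧ e then toℕ (y 0) + toℕ (y 1) else 4)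
                                                    (dec-true (y 0 ≟ᶠ y 0) refl) (dec-true (y 1 ≟ᶠ y 1) refl) ⟩
  toℕ (y 0) + toℕ (y 1)                        ≡⟨ cong (toℕ (y 0) +_) (+-identityʳ _) ⟨
  sum (applyUpTo (toℕ ∘ y) 2)                  ∎)
  where open ≡-Reasoning
weightBound-sound y (suc k) dom = begin
  extend (weightBound k (y 0) (y 1)) [ y (suc k) , y (2 + k) ]
    ≤⟨ extend-sound (weightBound k (y 0) (y 1)) (dom k ≤-refl) ⟩
  weightBound k (y 0) (y 1) [ y k , y (suc k) ] + toℕ (y (2 + k))
    ≤⟨ +-monoˡ-≤ _ (weightBound-sound y k λ i i<k → dom i (m<n⇒m<1+n i<k)) ⟩
  sum (applyUpTo (toℕ ∘ y) (2 + k)) + toℕ (y (2 + k))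
    ≡⟨ sum-applyUpTo-∷ʳ (toℕ ∘ y) (2 + k) ⟨
  sum (applyUpTo (toℕ ∘ y) (3 + k)) ∎
  where open ≤-Reasoning

weightBound-7-14 : ∀ p q → Raised 6 (weightBound 7 p q) (weightBound 14 p q)
weightBound-7-14 = toWitness {a? = all? λ p → all? λ q → raised? 6 (weightBound 7 p q) (weightBound 14 p q)} _

-- Stated with j + 7 rather than 7 + j: then weightBound (suc j + 7) unfolds in one step to
-- extend (weightBound (j + 7)), whereas 7 + suc j makes the type checker evaluate the tables symbolically.
weightBound-periodic : ∀ j p q → Raised 6 (weightBound (j + 7) p q) (weightBound (j + 14) p q)
weightBound-periodic zero    = weightBound-7-14
weightBound-periodic (suc j) p q =
  extend-raised (weightBound (j + 7) p q) (weightBound (j + 14) p q) (weightBound-periodic j p q)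

formula-+7 : ∀ x → formula (7 + x) ≡ 6 + formula x
formula-+7 x = begin
  (7 + x) ∸ ((7 + x) / 7) + bonus ((7 + x) % 7)
    ≡⟨ cong₂ (λ d r → (7 + x) ∸ d + bonus r) (m/n≡1+[m∸n]/n (m≤m+n 7 x))
             (trans (cong (_% 7) (+-comm 7 x)) ([m+n]%n≡m%n x 7)) ⟩
  (6 + x) ∸ (x / 7) + bonus (x % 7)
    ≡⟨ cong (_+ bonus (x % 7)) (+-∸-assoc 6 (m/n≤m x 7)) ⟩
  6 + (x ∸ x / 7) + bonus (x % 7)
    ≡⟨ +-assoc 6 (x ∸ x / 7) (bonus (x % 7)) ⟩
  6 + formula x ∎
  where
  open ≡-Reasoning
  bonus : ℕ → ℕ
  bonus r = if (r ≡ᵇ 1) ∨ (r ≡ᵇ 2) then 1 else 0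

-- p q are the first and a b the last two letters of a cyclic word of length 2 + k;
-- the hypotheses say that b and p are dominated across the wrap-around.
CyclicBound : ℕ → Set
CyclicBound k = ∀ p q a b → Dominated a b p → Dominated b p q → formula (2 + k) ≤ weightBound k p q [ a , b ]

cyclicBound? : ∀ k → Dec (CyclicBound k)
cyclicBound? k = all? λ p → all? λ q → all? λ a → all? λ b →
  dominated? a b p →-dec (dominated? b p q →-dec (formula (2 + k) ≤? weightBound k p q [ a , b ]))

cyclicBound-<14 : ∀ k → 1 ≤ k → k < 14 → CyclicBound k
cyclicBound-<14 k 1≤k k<14 =
  subst CyclicBound (toℕ-fromℕ< k<14) (checked (fromℕ< k<14) (subst (1 ≤_) (sym (toℕ-fromℕ< k<14)) 1≤k))
  where
  checked : ∀ (i : Fin 14) → 1 ≤ toℕ i → CyclicBound (toℕ i)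
  checked = toWitness {a? = all? λ i → 1 ≤? toℕ i →-dec cyclicBound? (toℕ i)} _

cyclicBound-+7 : ∀ j → CyclicBound (j + 7) → CyclicBound (j + 14)
cyclicBound-+7 j bounded p q a b ab-p bp-q = begin
  formula (2 + (j + 14))                ≡⟨ cong (λ x → formula (2 + x)) (+-assoc j 7 7) ⟨
  formula (2 + (j + 7 + 7))             ≡⟨ cong (λ x → formula (2 + x)) (+-comm (j + 7) 7) ⟩
  formula (7 + (2 + (j + 7)))           ≡⟨ formula-+7 (2 + (j + 7)) ⟩
  6 + formula (2 + (j + 7))             ≤⟨ +-monoʳ-≤ 6 (bounded p q a b ab-p bp-q) ⟩
  6 + weightBound (j + 7) p q [ a , b ] ≤⟨ weightBound-periodic j p q a b ⟩
  weightBound (j + 14) p q [ a , b ]    ∎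
  where open ≤-Reasoning

cyclicBound : ∀ k → 1 ≤ k → CyclicBound k
cyclicBound = <-rec (λ k → 1 ≤ k → CyclicBound k) step
  where
  step : ∀ k → (∀ {m} → m < k → 1 ≤ m → CyclicBound m) → 1 ≤ k → CyclicBound k
  step k rec 1≤k with k <? 14
  ... | yes k<14 = cyclicBound-<14 k 1≤k k<14
  -- The endpoints of subst are explicit: inferring them makes the unifier unfold weightBound.
  ... | no  k≮14 = subst CyclicBound {j + 14} {k} j+14≡k
                     (cyclicBound-+7 j (rec j+7<k (≤-trans (s≤s z≤n) (m≤n+m 7 j))))
    where
    j = k ∸ 14
    j+14≡k : j + 14 ≡ k
    j+14≡k = m∸n+n≡m (≮⇒≥ k≮14)
    j+7<k : j + 7 < k
    j+7<k = subst (j + 7 <_) j+14≡k (+-monoʳ-< j (m<m+n 7 z<s))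

cycle-lower-bound : ∀ n → 3 ≤ n → (f : Labelling n) → Is221Dom (cycleGraph n) f → formula n ≤ weight f
cycle-lower-bound (suc (suc k)) (s≤s (s≤s 1≤k)) f dom = begin
  formula (2 + k)                                ≤⟨ cyclicBound k 1≤k (y 0) (y 1) (y k) (y (suc k)) last first ⟩
  weightBound k (y 0) (y 1) [ y k , y (suc k) ]  ≤⟨ weightBound-sound y k interior ⟩
  sum (applyUpTo (toℕ ∘ y) (2 + k))              ≡⟨ weight-spells w-spells-f ⟨
  weight f                                       ∎
  where
  open ≤-Reasoning
  w = tabulate f
  w-spells-f = tabulate-spells f
  y = letter w
  interior : ∀ i → i < k → Dominated (y i) (y (suc i)) (y (2 + i))
  interior i i<k = begin
    demand (y (suc i))
      ≤⟨ cycle-demand w-spells-f dom (suc i) (s≤s (s≤s (<⇒≤ i<k))) ⟩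
    toℕ (y (2 + i)) + toℕ (y i) + (if i ≡ᵇ k then toℕ (y 0) else 0)
      ≡⟨ cong (λ d → toℕ (y (2 + i)) + toℕ (y i) + (if d then toℕ (y 0) else 0)) i≢k ⟩
    toℕ (y (2 + i)) + toℕ (y i) + 0
      ≡⟨ +-identityʳ _ ⟩
    toℕ (y (2 + i)) + toℕ (y i)
      ≡⟨ +-comm (toℕ (y (2 + i))) _ ⟩
    toℕ (y i) + toℕ (y (2 + i)) ∎
    where i≢k = dec-false (i ≟ k) (<⇒≢ i<k)
  last : Dominated (y k) (y (suc k)) (y 0)
  last = begin
    demand (y (suc k))
      ≤⟨ cycle-demand w-spells-f dom (suc k) ≤-refl ⟩
    toℕ (y (2 + k)) + toℕ (y k) + (if k ≡ᵇ k then toℕ (y 0) else 0)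
      ≡⟨ cong₂ (λ x d → toℕ x + toℕ (y k) + (if d then toℕ (y 0) else 0))
               (letter-beyond w (2 + k) (≤-reflexive (length-tabulate f))) (dec-true (k ≟ k) refl) ⟩
    toℕ (y k) + toℕ (y 0) ∎
  first : Dominated (y (suc k)) (y 0) (y 1)
  first = begin
    demand (y 0)
      ≤⟨ cycle-demand w-spells-f dom 0 (s≤s z≤n) ⟩
    toℕ (y 1) + 0 + (toℕ (y (suc k)) + 0)
      ≡⟨ cong₂ _+_ (+-identityʳ (toℕ (y 1))) (+-identityʳ (toℕ (y (suc k)))) ⟩
    toℕ (y 1) + toℕ (y (suc k))
      ≡⟨ +-comm (toℕ (y 1)) _ ⟩
    toℕ (y (suc k)) + toℕ (y 1) ∎

-- Optimal words

-- p is the letter before w; the letter after w is taken to be 0.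
allDominated : Fin 3 → List (Fin 3) → Bool
allDominated p []                = true
allDominated p (x ∷ [])          = ⌊ dominated? p x 0F ⌋
allDominated p (x ∷ w@(x′ ∷ _)) = ⌊ dominated? p x x′ ⌋ ∧ allDominated x w

allDominated-sound : ∀ p w → T (allDominated p w) →
  ∀ a → a < length w → Dominated (letter (p ∷ w) a) (letter w a) (letter w (suc a))
allDominated-sound p (x ∷ [])     ok zero    _         = toWitness ok
allDominated-sound p (x ∷ x′ ∷ w) ok zero    _         =
  toWitness (proj₁ (Equivalence.to (T-∧ {⌊ dominated? p x x′ ⌋}) ok))
allDominated-sound p (x ∷ x′ ∷ w) ok (suc a) (s≤s a<) =
  allDominated-sound x (x′ ∷ w) (proj₂ (Equivalence.to (T-∧ {⌊ dominated? p x x′ ⌋}) ok)) a a<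
allDominated-sound p (x ∷ [])     ok (suc a) (s≤s ())

block : List (Fin 3)
block = 0F ∷ 2F ∷ 1F ∷ 0F ∷ 1F ∷ 2F ∷ 0F ∷ []

allDominated-block : ∀ w → allDominated 0F (block ++ w) ≡ allDominated 0F w
allDominated-block []      = refl
allDominated-block (x ∷ w) = refl

optimalWord : ℕ → List (Fin 3)
optimalWord 0 = 0F ∷ 2F ∷ 1F ∷ []
optimalWord 1 = 0F ∷ 2F ∷ 2F ∷ 0F ∷ []
optimalWord 2 = 0F ∷ 2F ∷ 1F ∷ 2F ∷ 0F ∷ []
optimalWord 3 = 0F ∷ 2F ∷ 1F ∷ 0F ∷ 2F ∷ 1F ∷ []
optimalWord 4 = block
optimalWord 5 = 0F ∷ 2F ∷ 1F ∷ 0F ∷ 2F ∷ 1F ∷ 2F ∷ 0F ∷ []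
optimalWord 6 = 0F ∷ 2F ∷ 1F ∷ 0F ∷ 2F ∷ 1F ∷ 0F ∷ 2F ∷ 1F ∷ []
optimalWord (suc (suc (suc (suc (suc (suc (suc m))))))) = block ++ optimalWord m

optimalWord-spec : ∀ m →
  length (optimalWord m) ≡ 3 + m × sum (map toℕ (optimalWord m)) ≡ formula (3 + m)
  × T (allDominated 0F (optimalWord m))
optimalWord-spec 0 = refl , refl , _
optimalWord-spec 1 = refl , refl , _
optimalWord-spec 2 = refl , refl , _
optimalWord-spec 3 = refl , refl , _
optimalWord-spec 4 = refl , refl , _
optimalWord-spec 5 = refl , refl , _
optimalWord-spec 6 = refl , refl , _
optimalWord-spec (suc (suc (suc (suc (suc (suc (suc m))))))) with optimalWord-spec m
... | |w|≡3+m , Σw≡formula , ok =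
  cong (7 +_) |w|≡3+m ,
  trans (cong (6 +_) Σw≡formula) (sym (formula-+7 (3 + m))) ,
  subst T (sym (allDominated-block (optimalWord m))) ok

path-upper-bound : ∀ n → 3 ≤ n → Σ (Labelling n) λ f → Is221Dom (pathGraph n) f × weight f ≡ formula n
path-upper-bound (suc (suc (suc m))) (s≤s (s≤s (s≤s _))) with optimalWord-spec m
... | |w|≡3+m , Σw≡formula , ok =
  f ,
  Is221Dom-path w-spells-f (λ a a<3+m → allDominated-sound 0F w ok a (subst (a <_) (sym |w|≡3+m) a<3+m)) ,
  (begin
    weight f                                      ≡⟨ weight-spells {w = w} w-spells-f ⟩
    sum (applyUpTo (toℕ ∘ letter w) (3 + m))      ≡⟨ cong (sum ∘ applyUpTo (toℕ ∘ letter w)) |w|≡3+m ⟨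
    sum (applyUpTo (toℕ ∘ letter w) (length w))   ≡⟨ sum-letter w ⟩
    sum (map toℕ w)                               ≡⟨ Σw≡formula ⟩
    formula (3 + m)                               ∎)
  where
  open ≡-Reasoning
  w = optimalWord m
  f : Labelling (3 + m)
  f = letter w ∘ toℕ
  w-spells-f : Spells w f
  w-spells-f = |w|≡3+m , λ u → refl

proposition3p27 : (n : ℕ) → 3 ≤ n →
    Gamma221≡ (cycleGraph n) (formula n) × Gamma221≡ (pathGraph n) (formula n)
proposition3p27 n 3≤n with path-upper-bound n 3≤n
... | f , f-dominates-path , weight≡formula =
  ((f , path⇒cycle f f-dominates-path , weight≡formula) , cycle-lower-bound n 3≤n) ,
  ((f , f-dominates-path , weight≡formula) ,
   λ g g-dominates-path → cycle-lower-bound n 3≤n g (path⇒cycle g g-dominates-path))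
  where
  path⇒cycle : ∀ g → Is221Dom (pathGraph n) g → Is221Dom (cycleGraph n) g
  path⇒cycle = Is221Dom-∪ (pathGraph n) (wrapFirstGraph n ∪ wrapLastGraph n)
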